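{- Let $n\ge 2$ and $1\le i\le n-1$. Consider the linear compartmental model $\mathcal{M}_i=(P_n,\{1\},\{n\},\{i\})$, where $P_n$ is the directed path $1\to 2\to\cdots\to n$, the input is in compartment $1$, the output is compartment $n$, and the only leak is from compartment $i$. Its parameters are $Q_i=\{a_{21},a_{32},\ldots,a_{n(n-1)},a_{0i}\}$ ($a_{(k+1)k}$ the label of edge $k\to k+1$, $a_{0i}$ the leak rate). Then the input-output equation of $\mathcal{M}_i$ has the form $$y_n^{(n)}+c_{n-1}y_n^{(n-1)}+\cdots+c_1y_n'=d_0u_1,$$ (i.e. $c_0=0$ and $d_1=\cdots=d_{n-1}=0$), with $$c_j=\sigma_{n-j}(Q_i)-\left(a_{0i}a_{(i+1)i}\right)\cdot\sigma_{n-j-2}\big(Q_i\setminus\{a_{0i},a_{(i+1)i}\}\big)\quad\text{for } j\in\{1,\ldots,n-1\},$$ and $d_0=a_{21}a_{32}\cdots a_{n(n-1)}$.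
   Context: A linear compartmental model $\mathcal{M}=(G,\{in\},\{out\},Leak)$ consists of a directed graph $G$ on vertices $\{1,\ldots,n\}$ with a positive parameter (label) $a_{kj}$ for each edge $j\to k$, an input compartment $in$, an output compartment $out$, and a set $Leak$ of compartments $j$ each with a leak parameter $a_{0j}$. Its compartmental matrix $A$ has $A_{jj}=-\sum_{k:\,j\to k\in E}a_{kj}$ (minus additionally $a_{0j}$ if $j\in Leak$), $A_{kj}=a_{kj}$ if $j\to k$ is an edge, and $0$ otherwise; the model is the ODE system $\dot x=Ax+u$ with $u_j=0$ for $j\ne in$ and output $y_{out}=x_{out}$. Its input-output equation is the ODE $y_{out}^{(n)}+c_{n-1}y_{out}^{(n-1)}+\cdots+c_0y_{out}=d_{n-1}u_{in}^{(n-1)}+\cdots+d_0u_{in}$ obtained by eliminating the state variables; its coefficients are given as follows. Let $\widetilde G$ be $G$ with an extra vertex $0$ and an edge $j\to 0$ labeled $a_{0j}$ for each $j\in Leak$, and $\widetilde G^*$ be $\widetilde G$ with all edges leaving $out$ removed. An incoming forest is a set of edges whose underlying undirected graph has no cycle and in which no vertex has more than one outgoing edge; $\mathcal F_k(\cdot)$ denotes incoming forests with $k$ edges and $\mathcal F_k^{in,out}(\cdot)$ those that also contain a directed path from $in$ to $out$; the productivity $\pi_F$ is the product of the edge labels of $F$. Then $c_i=\sum_{F\in\mathcal F_{n-i}(\widetilde G)}\pi_F$ and $d_i=\sum_{F\in\mathcal F_{n-i-1}^{in,out}(\widetilde G^*)}\pi_F$. For a finite set of variables $Q$, $\sigma_k(Q)$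 is the $k$-th elementary symmetric polynomial (sum of all products of $k$ distinct elements of $Q$), with conventions $\sigma_0(Q)=1$ and $\sigma_k(Q)=0$ for $k<0$. -}

module Defs where

open import Data.Bool using (Bool; true; false; _∧_; _∨_; not)
open import Data.Nat using (ℕ; zero; suc; _≡ᵇ_) renaming (_+_ to _+ℕ_)
open import Data.Integer using (ℤ; +_; -[1+_]; _+_; _*_)
open import Data.List using (List; []; _∷_; _++_; map; filterᵇ; length; foldr; upTo)
open import Data.Bool.ListAction using (any; all)
open import Data.Product using (_×_; _,_)

-- A labelled directed edge  src → tgt  with label (parameter value) in ℤ.
-- Vertices are natural numbers; vertex 0 is the extra "leak" vertex of G̃.
record Edge : Set where
  constructor edge
  field
    src   : ℕ
    tgt   : ℕ
    label : ℤ
open Edge public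

-- A linear compartmental model (G, {in}, {out}, Leak) on vertices 1..n.
-- edges: edges of G with their labels a_kj; leaks: pairs (j , a_0j).
record Model : Set where
  field
    size  : ℕ
    edges : List Edge
    inp   : ℕ
    out   : ℕ
    leaks : List (ℕ × ℤ)
open Model public

Gtilde : Model → List Edge
Gtilde M = edges M ++ map (λ { (j , l) → edge j 0 l }) (leaks M)

GtildeStar : Model → List Edge
GtildeStar M = filterᵇ (λ e → not (src e ≡ᵇ out M)) (Gtilde M)

subsets : {A : Set} → List A → List (List A)
subsets [] = [] ∷ []
subsets (x ∷ xs) = map (x ∷_) (subsets xs) ++ subsets xs

uReach : ℕ → List Edge → ℕ → ℕ → Bool
uReach zero    F u v = u ≡ᵇ v
uReach (suc k) F u v =
  uReach k F u v ∨
  any (λ e → ((src e ≡ᵇ u) ∧ uReach k F (tgt e) v) ∨ ((tgt e ≡ᵇ u) ∧ uReach k F (src e) v)) F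

dReach : ℕ → List Edge → ℕ → ℕ → Bool
dReach zero    F u v = u ≡ᵇ v
dReach (suc k) F u v =
  dReach k F u v ∨ any (λ e → (src e ≡ᵇ u) ∧ dReach k F (tgt e) v) F

removeEach : {A : Set} → List A → List (A × List A)
removeEach [] = []
removeEach (x ∷ xs) = (x , xs) ∷ map (λ { (y , ys) → (y , x ∷ ys) }) (removeEach xs)

-- The underlying undirected (multi)graph of F has no cycle:
-- no edge has its endpoints connected by F minus that edge
-- (a cycle exists iff some edge lies on a cycle; self-loops and parallel edges are cycles).
acyclic : List Edge → Bool
acyclic F = all (λ { (e , rest) → not (uReach (length rest) rest (src e) (tgt e)) }) (removeEach F)

outdegLeq1 : List Edge → Bool
outdegLeq1 F = all (λ e → length (filterᵇ (λ e′ → src e′ ≡ᵇ src e) F) ≡ᵇ 1) F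

isIncomingForest : List Edge → Bool
isIncomingForest F = acyclic F ∧ outdegLeq1 F

hasPath : ℕ → ℕ → List Edge → Bool
hasPath a b F = dReach (length F) F a b

sumℤ : List ℤ → ℤ
sumℤ = foldr _+_ (+ 0)

prodℤ : List ℤ → ℤ
prodℤ = foldr _*_ (+ 1)

productivity : List Edge → ℤ
productivity F = prodℤ (map label F)

forests : ℕ → List Edge → List (List Edge)
forests k E = filterᵇ (λ F → (length F ≡ᵇ k) ∧ isIncomingForest F) (subsets E)

forestsPath : ℕ → ℕ → ℕ → List Edge → List (List Edge)
forestsPath a b k E = filterᵇ (hasPath a b) (forests k E)

-- coefficients of the input-output equation
-- c_i = Σ_{F ∈ 𝓕_{n-i}(G̃)} π_F
cCoeff : Model → ℕ → ℤ
cCoeff M i = sumℤ (map productivity (forests (size M Data.Nat.∸ i) (Gtilde M)))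

dCoeff : Model → ℕ → ℤ
dCoeff M i = sumℤ (map productivity
  (forestsPath (inp M) (out M) (size M Data.Nat.∸ i Data.Nat.∸ 1) (GtildeStar M)))

σ : ℕ → List ℤ → ℤ
σ zero    _        = + 1
σ (suc k) []       = + 0
σ (suc k) (x ∷ xs) = x * σ k xs + σ (suc k) xs

σℤ : ℤ → List ℤ → ℤ
σℤ (+ k)    Q = σ k Q
σℤ -[1+ _ ] Q = + 0

oneTo : ℕ → List ℕ
oneTo m = map suc (upTo m)

-- The model 𝓜_i = (P_n, {1}, {n}, {i}); a k is the label a_{(k+1)k} of edge k → k+1,
-- ℓ is the leak label a_{0i}.
pathModel : (n i : ℕ) → (a : ℕ → ℤ) → (ℓ : ℤ) → Model
pathModel n i a ℓ = record
  { size  = n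
  ; edges = map (λ k → edge k (suc k) (a k)) (oneTo (n Data.Nat.∸ 1))
  ; inp   = 1
  ; out   = n
  ; leaks = (i , ℓ) ∷ []
  }

Qset : (n : ℕ) → (a : ℕ → ℤ) → (ℓ : ℤ) → List ℤ
Qset n a ℓ = map a (oneTo (n Data.Nat.∸ 1)) ++ (ℓ ∷ [])

Qminus : (n i : ℕ) → (a : ℕ → ℤ) → List ℤ
Qminus n i a = map a (filterᵇ (λ k → not (k ≡ᵇ i)) (oneTo (n Data.Nat.∸ 1)))

module Submission where

-- G̃ is a tree: the path 1 → 2 → ⋯ → n together with the leak edge i → 0. Hence every edge set is
-- acyclic, and the incoming forests are exactly the edge sets in which no two edges share a source.
-- The only two edges with a common source are i → i+1 and i → 0, so by inclusion–exclusion
-- c_j = σ_{n-j}(Q_i) − a_{0i} a_{(i+1)i} σ_{n-j-2}(Q_i ∖ {a_{0i}, a_{(i+1)i}}), and c_0 = 0 because the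
-- full edge set contains the clash. Each edge advances a vertex by at most one, so a directed path
-- 1 ⇝ n needs all n − 1 path edges: d_j = 0 for j ≥ 1, and the only forest counted by d_0 is the path
-- itself (a forest containing the leak misses i → i+1, and then no edge leaves {0, …, i}).

open import Defs
open import Data.Bool using (Bool; true; false; T; T?; not; _∧_)
open import Data.Bool.Properties using (T-∧; T-∨; T-≡; ∧-assoc; ∧-identityʳ)
open import Data.Bool.ListAction using (all)
open import Data.Empty using (⊥-elim)
open import Data.Nat using (ℕ; zero; suc; _≤_; _∸_; _≡ᵇ_; _≟_; z≤n; s≤s) renaming (_+_ to _+ℕ_)
import Data.Nat as ℕ
import Data.Nat.Properties as ℕ
open import Data.Integer using (ℤ; +_; _+_; _-_; _*_; _<_)
import Data.Integer.Properties as ℤ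
open import Data.Integer.Tactic.RingSolver using (solve-∀)
open import Data.List using (List; []; _∷_; _++_; [_]; map; filterᵇ; length; upTo)
open import Data.List.Properties
  using (filter-++; filter-none; filter-all; filter-some; filter-accept; filter-reject;
         map-++; map-∘; length-++; length-map; length-upTo)
open import Data.List.Membership.Propositional using (_∈_; find)
open import Data.List.Membership.Propositional.Properties
  using (∈-++⁻; ∈-++⁺ˡ; ∈-++⁺ʳ; ∈-map⁻; ∈-map⁺; ∈-upTo⁺; ∈-upTo⁻)
open import Data.List.Relation.Unary.All as All using (All; []; _∷_)
import Data.List.Relation.Unary.All.Properties as All
open import Data.List.Relation.Unary.Any as Any using (Any; here; there)
open import Data.List.Relation.Unary.Any.Properties using (any⁺; any⁻)
open import Data.List.Relation.Unary.AllPairs as AllPairs using (AllPairs; []; _∷_)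
import Data.List.Relation.Unary.AllPairs.Properties as AllPairs
open import Data.List.Relation.Binary.Sublist.Propositional using (_⊆_; []; _∷_; _∷ʳ_; ⊆-refl; minimum; lookup)
open import Data.List.Relation.Binary.Sublist.Propositional.Properties
  using (All-resp-⊆; to-≋) renaming (++⁺ʳ to ⊆-++⁺ʳ)
open import Data.List.Relation.Binary.Equality.Propositional using (≋⇒≡)
open import Data.Product using (_×_; _,_; proj₁; proj₂)
open import Data.Sum using (inj₁; inj₂)
open import Function using (_∘_; _⇔_; mk⇔; Equivalence; id; const)
open import Level using (Level; 0ℓ)
open import Relation.Nullary using (¬_; Dec; yes; no; does; ¬?)
open import Relation.Nullary.Decidable using (dec-true; does-⇔)
open import Relation.Unary using (Pred; Decidable)
open import Relation.Binary.PropositionalEquality hiding ([_])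

private
  variable
    ℓ′ : Level
    A : Set

T-does⇔ : {P : Set ℓ′} (P? : Dec P) → T (does P?) ⇔ P
T-does⇔ (yes p) = mk⇔ (const p) (const _)
T-does⇔ (no ¬p) = mk⇔ (λ ()) ¬p

≢⇒T-not-≡ᵇ : ∀ {m n} → m ≢ n → T (not (m ≡ᵇ n))
≢⇒T-not-≡ᵇ {m} {n} = Equivalence.from (T-does⇔ (¬? (m ≟ n)))

filterᵇ-cong : ∀ {p q : A → Bool} xs → (∀ {x} → x ∈ xs → p x ≡ q x) → filterᵇ p xs ≡ filterᵇ q xs
filterᵇ-cong [] _ = refl
filterᵇ-cong {p = p} {q} (x ∷ xs) p≗q
  with p x | q x | p≗q (here refl) | filterᵇ-cong xs (p≗q ∘ there)
... | true  | true  | refl | eq = cong (x ∷_) eq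
... | false | false | refl | eq = eq

filterᵇ-map : ∀ {B : Set} (p : B → Bool) (f : A → B) xs →
  filterᵇ p (map f xs) ≡ map f (filterᵇ (p ∘ f) xs)
filterᵇ-map p f [] = refl
filterᵇ-map p f (x ∷ xs) with p (f x)
... | true  = cong (f x ∷_) (filterᵇ-map p f xs)
... | false = filterᵇ-map p f xs

filterᵇ-filterᵇ : ∀ (p q : A → Bool) xs →
  filterᵇ q (filterᵇ p xs) ≡ filterᵇ (λ x → p x ∧ q x) xs
filterᵇ-filterᵇ p q [] = refl
filterᵇ-filterᵇ p q (x ∷ xs) with p x
... | false = filterᵇ-filterᵇ p q xs
... | true with q x
...   | true  = cong (x ∷_) (filterᵇ-filterᵇ p q xs)
...   | false = filterᵇ-filterᵇ p q xs

all-cong : ∀ {p q : A → Bool} xs → (∀ {x} → x ∈ xs → p x ≡ q x) → all p xs ≡ all q xs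
all-cong []       p≗q = refl
all-cong (x ∷ xs) p≗q = cong₂ _∧_ (p≗q (here refl)) (all-cong xs (p≗q ∘ there))

AllPairs-resp-⊆ : ∀ {R : A → A → Set ℓ′} {xs ys} → xs ⊆ ys → AllPairs R ys → AllPairs R xs
AllPairs-resp-⊆ []         []         = []
AllPairs-resp-⊆ (_ ∷ʳ τ)   (_ ∷ Rys)  = AllPairs-resp-⊆ τ Rys
AllPairs-resp-⊆ (refl ∷ τ) (Ry ∷ Rys) = All-resp-⊆ τ Ry ∷ AllPairs-resp-⊆ τ Rys

⊆-++-[]⁻ : ∀ {P : Pred A ℓ′} {F} xs {y} → All P F → ¬ P y → F ⊆ xs ++ [ y ] → F ⊆ xs
⊆-++-[]⁻ []       _        _   (_ ∷ʳ [])   = []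
⊆-++-[]⁻ []       (Py ∷ _) ¬Py (refl ∷ []) = ⊥-elim (¬Py Py)
⊆-++-[]⁻ (x ∷ xs) PF       ¬Py (_ ∷ʳ τ)    = x ∷ʳ ⊆-++-[]⁻ xs PF ¬Py τ
⊆-++-[]⁻ (x ∷ xs) (_ ∷ PF) ¬Py (refl ∷ τ)  = refl ∷ ⊆-++-[]⁻ xs PF ¬Py τ

⊆∧length≡⇒≡ : ∀ {xs ys : List A} → xs ⊆ ys → length xs ≡ length ys → xs ≡ ys
⊆∧length≡⇒≡ τ len = ≋⇒≡ (to-≋ len τ)

∈-subsets⇒⊆ : ∀ (xs : List A) {F} → F ∈ subsets xs → F ⊆ xs
∈-subsets⇒⊆ [] (here refl) = []
∈-subsets⇒⊆ (x ∷ xs) F∈ with ∈-++⁻ (map (x ∷_) (subsets xs)) F∈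
... | inj₂ F∈′ = x ∷ʳ ∈-subsets⇒⊆ xs F∈′
... | inj₁ F∈′ with _ , F∈″ , refl ← ∈-map⁻ (x ∷_) F∈′ = refl ∷ ∈-subsets⇒⊆ xs F∈″

length-oneTo : ∀ N → length (oneTo N) ≡ N
length-oneTo N = trans (length-map suc (upTo N)) (length-upTo N)

-- Elementary symmetric polynomials

σ-∷ʳ : ∀ k xs y → σ (suc k) (xs ++ [ y ]) ≡ σ (suc k) xs + y * σ k xs
σ-∷ʳ k [] y = solve y (σ k [])
  where
    solve : ∀ y s → y * s + + 0 ≡ + 0 + y * s
    solve = solve-∀
σ-∷ʳ zero (x ∷ xs) y = trans (cong (λ s → x * + 1 + s) (σ-∷ʳ zero xs y)) (solve x y (σ 1 xs))
  where
    solve : ∀ x y s → x * + 1 + (s + y * + 1) ≡ x * + 1 + s + y * + 1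
    solve = solve-∀
σ-∷ʳ (suc k) (x ∷ xs) y =
  trans (cong₂ (λ s t → x * s + t) (σ-∷ʳ k xs y) (σ-∷ʳ (suc k) xs y))
        (solve x y (σ k xs) (σ (suc k) xs) (σ (suc (suc k)) xs))
  where
    solve : ∀ x y s₀ s₁ s₂ → x * (s₁ + y * s₀) + (s₂ + y * s₁) ≡ x * s₁ + s₂ + y * (x * s₀ + s₁)
    solve = solve-∀

σ-length< : ∀ k xs → length xs ℕ.< k → σ k xs ≡ + 0
σ-length< (suc k) []       _          = refl
σ-length< (suc k) (x ∷ xs) (s≤s len<) = begin
  x * σ k xs + σ (suc k) xs
    ≡⟨ cong₂ (λ s t → x * s + t) (σ-length< k xs len<) (σ-length< (suc k) xs (ℕ.m<n⇒m<1+n len<)) ⟩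
  x * + 0 + + 0
    ≡⟨ cong (_+ + 0) (ℤ.*-zeroʳ x) ⟩
  + 0
    ∎
  where open ≡-Reasoning

σ-length : ∀ xs → σ (length xs) xs ≡ prodℤ xs
σ-length []       = refl
σ-length (x ∷ xs) =
  trans (cong₂ (λ s t → x * s + t) (σ-length xs) (σ-length< (suc (length xs)) xs ℕ.≤-refl))
        (ℤ.+-identityʳ (x * prodℤ xs))

σ₋₂ : ℕ → List ℤ → ℤ
σ₋₂ (suc (suc k)) xs = σ k xs
σ₋₂ _             _  = + 0

σ₋₂-∷ : ∀ k x xs → σ₋₂ (suc k) (x ∷ xs) ≡ x * σ₋₂ k xs + σ₋₂ (suc k) xs
σ₋₂-∷ zero          x xs = sym (cong (_+ + 0) (ℤ.*-zeroʳ x))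
σ₋₂-∷ (suc zero)    x xs = sym (cong (_+ + 1) (ℤ.*-zeroʳ x))
σ₋₂-∷ (suc (suc k)) x xs = refl

σℤ≡σ₋₂ : ∀ {n j} → j ≤ n → ∀ xs → σℤ (+ n - + j - + 2) xs ≡ σ₋₂ (n ∸ j) xs
σℤ≡σ₋₂ {n} {j} j≤n xs rewrite ℤ.m-n≡m⊖n n j | ℤ.⊖-≥ j≤n = shift (n ∸ j)
  where
    shift : ∀ k → σℤ (+ k - + 2) xs ≡ σ₋₂ k xs
    shift zero          = refl
    shift (suc zero)    = refl
    shift (suc (suc k)) = refl

σ-∷-++-[] : ∀ k x V y →
  x * σ k V + σ (suc k) (V ++ [ y ]) ≡ σ (suc k) (x ∷ V ++ [ y ]) - (x * y) * σ₋₂ (suc k) V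
σ-∷-++-[] zero x V y = solve x y (σ 1 (V ++ [ y ]))
  where
    solve : ∀ x y s → x * + 1 + s ≡ (x * + 1 + s) - (x * y) * + 0
    solve = solve-∀
σ-∷-++-[] (suc k) x V y =
  trans (solve x y (σ k V) (σ (suc k) V) (σ (suc (suc k)) (V ++ [ y ])))
        (cong (λ s → x * s + σ (suc (suc k)) (V ++ [ y ]) - (x * y) * σ k V) (sym (σ-∷ʳ k V y)))
  where
    solve : ∀ x y s₀ s₁ t → x * s₁ + t ≡ x * (s₁ + y * s₀) + t - (x * y) * s₀
    solve = solve-∀

-- Sums of productivities over sub-lists

Σπ : List (List Edge) → ℤ
Σπ 𝓕 = sumℤ (map productivity 𝓕)

Σπ-++ : ∀ 𝓕 𝓖 → Σπ (𝓕 ++ 𝓖) ≡ Σπ 𝓕 + Σπ 𝓖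
Σπ-++ []      𝓖 = sym (ℤ.+-identityˡ (Σπ 𝓖))
Σπ-++ (F ∷ 𝓕) 𝓖 = trans (cong (λ s → productivity F + s) (Σπ-++ 𝓕 𝓖))
                        (sym (ℤ.+-assoc (productivity F) (Σπ 𝓕) (Σπ 𝓖)))

Σπ-map-∷ : ∀ e 𝓕 → Σπ (map (e ∷_) 𝓕) ≡ label e * Σπ 𝓕
Σπ-map-∷ e []      = sym (ℤ.*-zeroʳ (label e))
Σπ-map-∷ e (F ∷ 𝓕) = trans (cong (λ s → label e * productivity F + s) (Σπ-map-∷ e 𝓕))
                           (sym (ℤ.*-distribˡ-+ (label e) (productivity F) (Σπ 𝓕)))

-- cCoeff M j unfolds to  subsetSum (size M ∸ j) isIncomingForest (Gtilde M).
subsetSum : ℕ → (List Edge → Bool) → List Edge → ℤ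
subsetSum k p E = Σπ (filterᵇ (λ F → (length F ≡ᵇ k) ∧ p F) (subsets E))

private
  subsetSum-∷ : ∀ k p e E → subsetSum k p (e ∷ E) ≡
    label e * Σπ (filterᵇ (λ F → (suc (length F) ≡ᵇ k) ∧ p (e ∷ F)) (subsets E)) + subsetSum k p E
  subsetSum-∷ k p e E = begin
    Σπ (filterᵇ q (map (e ∷_) S ++ S))
      ≡⟨ cong Σπ (filter-++ (T? ∘ q) (map (e ∷_) S) S) ⟩
    Σπ (filterᵇ q (map (e ∷_) S) ++ filterᵇ q S)
      ≡⟨ Σπ-++ (filterᵇ q (map (e ∷_) S)) (filterᵇ q S) ⟩
    Σπ (filterᵇ q (map (e ∷_) S)) + subsetSum k p E
      ≡⟨ cong (λ 𝓕 → Σπ 𝓕 + subsetSum k p E) (filterᵇ-map q (e ∷_) S) ⟩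
    Σπ (map (e ∷_) (filterᵇ (q ∘ (e ∷_)) S)) + subsetSum k p E
      ≡⟨ cong (_+ subsetSum k p E) (Σπ-map-∷ e (filterᵇ (q ∘ (e ∷_)) S)) ⟩
    label e * Σπ (filterᵇ (q ∘ (e ∷_)) S) + subsetSum k p E
      ∎
    where
      open ≡-Reasoning
      S = subsets E
      q = λ F → (length F ≡ᵇ k) ∧ p F

subsetSum-suc-∷ : ∀ k p e E →
  subsetSum (suc k) p (e ∷ E) ≡ label e * subsetSum k (p ∘ (e ∷_)) E + subsetSum (suc k) p E
subsetSum-suc-∷ k = subsetSum-∷ (suc k)

subsetSum-zero-∷ : ∀ p e E → subsetSum 0 p (e ∷ E) ≡ subsetSum 0 p E
subsetSum-zero-∷ p e E = begin
  subsetSum 0 p (e ∷ E)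
    ≡⟨ subsetSum-∷ 0 p e E ⟩
  label e * Σπ (filterᵇ (λ _ → false) (subsets E)) + subsetSum 0 p E
    ≡⟨ cong (λ 𝓕 → label e * Σπ 𝓕 + subsetSum 0 p E)
            (filter-none (T? ∘ λ _ → false) (All.universal (λ _ ()) (subsets E))) ⟩
  label e * + 0 + subsetSum 0 p E
    ≡⟨ cong (_+ subsetSum 0 p E) (ℤ.*-zeroʳ (label e)) ⟩
  + 0 + subsetSum 0 p E
    ≡⟨ ℤ.+-identityˡ (subsetSum 0 p E) ⟩
  subsetSum 0 p E
    ∎
  where open ≡-Reasoning

subsetSum-zero : ∀ p E → T (p []) → subsetSum 0 p E ≡ + 1
subsetSum-zero p []      p[] with p []
... | true = refl
subsetSum-zero p (e ∷ E) p[] = trans (subsetSum-zero-∷ p e E) (subsetSum-zero p E p[])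

subsetSum-none : ∀ k p E → (∀ {F} → F ⊆ E → length F ≡ k → ¬ T (p F)) → subsetSum k p E ≡ + 0
subsetSum-none k p E ¬p = cong Σπ (filter-none (T? ∘ q) (All.tabulate rejected))
  where
    q = λ F → (length F ≡ᵇ k) ∧ p F
    rejected : ∀ {F} → F ∈ subsets E → ¬ T (q F)
    rejected F∈ qF with lenF , pF ← Equivalence.to T-∧ qF =
      ¬p (∈-subsets⇒⊆ E F∈) (ℕ.≡ᵇ⇒≡ _ k lenF) pF

subsetSum-cong : ∀ k {p q} E → (∀ {F} → F ⊆ E → length F ≡ k → p F ≡ q F) →
  subsetSum k p E ≡ subsetSum k q E
subsetSum-cong k {p} {q} E p≗q = cong Σπ (filterᵇ-cong (subsets E) agree)
  where
    agree : ∀ {F} → F ∈ subsets E → (length F ≡ᵇ k) ∧ p F ≡ (length F ≡ᵇ k) ∧ q F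
    agree {F} F∈ with length F ≡ᵇ k in lenF
    ... | false = refl
    ... | true  = p≗q (∈-subsets⇒⊆ E F∈) (ℕ.≡ᵇ⇒≡ _ k (subst T (sym lenF) _))

subsetSum-all : ∀ k p E → (∀ {F} → F ⊆ E → T (p F)) → subsetSum k p E ≡ σ k (map label E)
subsetSum-all zero    p E       pE = subsetSum-zero p E (pE (minimum E))
subsetSum-all (suc k) p []      pE = refl
subsetSum-all (suc k) p (e ∷ E) pE = begin
  subsetSum (suc k) p (e ∷ E)
    ≡⟨ subsetSum-suc-∷ k p e E ⟩
  label e * subsetSum k (p ∘ (e ∷_)) E + subsetSum (suc k) p E
    ≡⟨ cong₂ (λ s t → label e * s + t) (subsetSum-all k (p ∘ (e ∷_)) E (λ F⊆ → pE (refl ∷ F⊆)))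
                                       (subsetSum-all (suc k) p E (λ F⊆ → pE (e ∷ʳ F⊆))) ⟩
  σ (suc k) (map label (e ∷ E))
    ∎
  where open ≡-Reasoning

subsetSum-avoiding-last : ∀ k {P : Pred Edge ℓ′} (P? : Decidable P) {xs y} → All P xs → ¬ P y →
  subsetSum k (does ∘ All.all? P?) (xs ++ [ y ]) ≡ σ k (map label xs)
subsetSum-avoiding-last zero P? {xs} {y} _ _ = subsetSum-zero (does ∘ All.all? P?) (xs ++ [ y ]) _
subsetSum-avoiding-last (suc k) P? {[]} {y} [] ¬Py = begin
  subsetSum (suc k) (does ∘ All.all? P?) [ y ]
    ≡⟨ subsetSum-suc-∷ k (does ∘ All.all? P?) y [] ⟩
  label y * subsetSum k (λ F → does (All.all? P? (y ∷ F))) [] + + 0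
    ≡⟨ cong (λ s → label y * s + + 0) (subsetSum-none k (λ F → does (All.all? P? (y ∷ F))) [] ¬P[y∷F]) ⟩
  label y * + 0 + + 0
    ≡⟨ cong (_+ + 0) (ℤ.*-zeroʳ (label y)) ⟩
  + 0
    ∎
  where
    open ≡-Reasoning
    ¬P[y∷F] : ∀ {F} → F ⊆ [] → length F ≡ k → ¬ T (does (All.all? P? (y ∷ F)))
    ¬P[y∷F] _ _ t = ¬Py (Equivalence.to (T-does⇔ (P? y)) (proj₁ (Equivalence.to (T-∧ {does (P? y)}) t)))
subsetSum-avoiding-last (suc k) P? {x ∷ xs} {y} (Px ∷ Pxs) ¬Py = begin
  subsetSum (suc k) p (x ∷ xs ++ [ y ])
    ≡⟨ subsetSum-suc-∷ k p x (xs ++ [ y ]) ⟩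
  label x * subsetSum k (p ∘ (x ∷_)) (xs ++ [ y ]) + subsetSum (suc k) p (xs ++ [ y ])
    ≡⟨ cong (λ s → label x * s + subsetSum (suc k) p (xs ++ [ y ]))
            (subsetSum-cong k (xs ++ [ y ]) λ {F} _ _ → cong (_∧ p F) (dec-true (P? x) Px)) ⟩
  label x * subsetSum k p (xs ++ [ y ]) + subsetSum (suc k) p (xs ++ [ y ])
    ≡⟨ cong₂ (λ s t → label x * s + t) (subsetSum-avoiding-last k P? Pxs ¬Py)
                                       (subsetSum-avoiding-last (suc k) P? Pxs ¬Py) ⟩
  σ (suc k) (map label (x ∷ xs))
    ∎
  where
    open ≡-Reasoning
    p = does ∘ All.all? P?

forestsPath≡subsetSum : ∀ u v k E →
  Σπ (forestsPath u v k E) ≡ subsetSum k (λ F → isIncomingForest F ∧ hasPath u v F) E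
forestsPath≡subsetSum u v k E = cong Σπ (trans (filterᵇ-filterᵇ _ (hasPath u v) (subsets E))
  (filterᵇ-cong (subsets E) (λ {F} _ → ∧-assoc (length F ≡ᵇ k) (isIncomingForest F) (hasPath u v F))))

-- Edge sets in which no two edges share a source

DistinctSources : List Edge → Set
DistinctSources = AllPairs (λ e f → src e ≢ src f)

distinctSources? : Decidable DistinctSources
distinctSources? = AllPairs.allPairs? (λ e f → ¬? (src e ≟ src f))

hasDistinctSources : List Edge → Bool
hasDistinctSources F = does (distinctSources? F)

src-injective : ∀ {F e f} → DistinctSources F → e ∈ F → f ∈ F → src e ≡ src f → e ≡ f
src-injective (_ ∷ _)  (here refl) (here refl) _    = refl
src-injective (e≢ ∷ _) (here refl) (there f∈)  same = ⊥-elim (All.lookup e≢ f∈ same)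
src-injective (f≢ ∷ _) (there e∈)  (here refl) same = ⊥-elim (All.lookup f≢ e∈ (sym same))
src-injective (_ ∷ D)  (there e∈)  (there f∈)  same = src-injective D e∈ f∈ same

sourceCount : List Edge → ℕ → ℕ
sourceCount F v = length (filterᵇ (λ e → src e ≡ᵇ v) F)

sourceCount-∷-src : ∀ x F → sourceCount (x ∷ F) (src x) ≡ suc (sourceCount F (src x))
sourceCount-∷-src x F =
  cong length (filter-accept (T? ∘ λ e → src e ≡ᵇ src x) {x} {F} (ℕ.≡⇒≡ᵇ (src x) (src x) refl))

sourceCount-∷-≢ : ∀ x F {v} → src x ≢ v → sourceCount (x ∷ F) v ≡ sourceCount F v
sourceCount-∷-≢ x F {v} x≢v =
  cong length (filter-reject (T? ∘ λ e → src e ≡ᵇ v) {x} {F} (x≢v ∘ ℕ.≡ᵇ⇒≡ (src x) v))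

sourceCount≡0⇔ : ∀ F v → sourceCount F v ≡ 0 ⇔ All (λ f → v ≢ src f) F
sourceCount≡0⇔ F v = mk⇔ to from
  where
    p = λ e → src e ≡ᵇ v
    to : sourceCount F v ≡ 0 → All (λ f → v ≢ src f) F
    to count≡0 = All.tabulate λ {f} f∈ v≡src → ℕ.<-irrefl (sym count≡0)
      (filter-some (T? ∘ p) (Any.map (λ { refl → ℕ.≡⇒≡ᵇ (src f) v (sym v≡src) }) f∈))
    from : All (λ f → v ≢ src f) F → sourceCount F v ≡ 0
    from v≢ = cong length
      (filter-none (T? ∘ p) {F} (All.map (λ {f} v≢src t → v≢src (sym (ℕ.≡ᵇ⇒≡ (src f) v t))) v≢))

outdegLeq1-∷ : ∀ x F → T (outdegLeq1 (x ∷ F)) ⇔ (All (λ f → src x ≢ src f) F × T (outdegLeq1 F))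
outdegLeq1-∷ x F = mk⇔ to from
  where
    open Equivalence (sourceCount≡0⇔ F (src x)) renaming (to to count⇒; from to count⇐)
    c = sourceCount F (src x)
    head⇒ : T (sourceCount (x ∷ F) (src x) ≡ᵇ 1) → All (λ f → src x ≢ src f) F
    head⇒ t = count⇒ (ℕ.≡ᵇ⇒≡ c 0 (subst (λ m → T (m ≡ᵇ 1)) (sourceCount-∷-src x F) t))
    head⇐ : All (λ f → src x ≢ src f) F → T (sourceCount (x ∷ F) (src x) ≡ᵇ 1)
    head⇐ x≢ = subst (λ m → T (m ≡ᵇ 1)) (sym (sourceCount-∷-src x F)) (ℕ.≡⇒≡ᵇ c 0 (count⇐ x≢))
    tail≡ : All (λ f → src x ≢ src f) F → all (λ e → sourceCount (x ∷ F) (src e) ≡ᵇ 1) F ≡ outdegLeq1 F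
    tail≡ x≢ = all-cong F (λ f∈ → cong (_≡ᵇ 1) (sourceCount-∷-≢ x F (All.lookup x≢ f∈)))
    to : T (outdegLeq1 (x ∷ F)) → All (λ f → src x ≢ src f) F × T (outdegLeq1 F)
    to t with h , rest ← Equivalence.to T-∧ t = head⇒ h , subst T (tail≡ (head⇒ h)) rest
    from : All (λ f → src x ≢ src f) F × T (outdegLeq1 F) → T (outdegLeq1 (x ∷ F))
    from (x≢ , t) = Equivalence.from T-∧ (head⇐ x≢ , subst T (sym (tail≡ x≢)) t)

outdegLeq1⇔DistinctSources : ∀ F → T (outdegLeq1 F) ⇔ DistinctSources F
outdegLeq1⇔DistinctSources []      = mk⇔ (λ _ → []) (λ _ → _)
outdegLeq1⇔DistinctSources (x ∷ F) = mk⇔ to from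
  where
    open Equivalence (outdegLeq1⇔DistinctSources F) renaming (to to tail⇒; from to tail⇐)
    to : T (outdegLeq1 (x ∷ F)) → DistinctSources (x ∷ F)
    to t with x≢ , t′ ← Equivalence.to (outdegLeq1-∷ x F) t = x≢ ∷ tail⇒ t′
    from : DistinctSources (x ∷ F) → T (outdegLeq1 (x ∷ F))
    from (x≢ ∷ D) = Equivalence.from (outdegLeq1-∷ x F) (x≢ , tail⇐ D)

outdegLeq1≡hasDistinctSources : ∀ F → outdegLeq1 F ≡ hasDistinctSources F
outdegLeq1≡hasDistinctSources F =
  does-⇔ (outdegLeq1⇔DistinctSources F) (T? (outdegLeq1 F)) (distinctSources? F)

subsetSum-∷-unclashed : ∀ k u E → All (λ f → src u ≢ src f) E →
  subsetSum (suc k) hasDistinctSources (u ∷ E)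
    ≡ label u * subsetSum k hasDistinctSources E + subsetSum (suc k) hasDistinctSources E
subsetSum-∷-unclashed k u E u≢E =
  trans (subsetSum-suc-∷ k hasDistinctSources u E)
        (cong (λ s → label u * s + subsetSum (suc k) hasDistinctSources E) (subsetSum-cong k E unclashed))
  where
    unclashed : ∀ {F} → F ⊆ E → length F ≡ k → hasDistinctSources (u ∷ F) ≡ hasDistinctSources F
    unclashed {F} F⊆ _ =
      cong (_∧ hasDistinctSources F) (dec-true (All.all? (λ f → ¬? (src u ≟ src f)) F) (All-resp-⊆ F⊆ u≢E))

-- Inclusion–exclusion: the sub-lists with distinct sources are all sub-lists except those
-- containing both x and y.
subsetSum-oneClash : ∀ k {xs x y} → DistinctSources xs → x ∈ xs → src x ≡ src y →
  subsetSum k hasDistinctSources (xs ++ [ y ]) ≡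
    σ k (map label (xs ++ [ y ]))
    - (label x * label y) * σ₋₂ k (map label (filterᵇ (λ e → not (src e ≡ᵇ src y)) xs))
subsetSum-oneClash zero {xs} {x} {y} _ _ _ =
  trans (subsetSum-zero hasDistinctSources (xs ++ [ y ]) _) (solve (label x * label y))
  where
    solve : ∀ c → + 1 ≡ + 1 - c * + 0
    solve = solve-∀
subsetSum-oneClash (suc k) {x ∷ vs} {x} {y} (x≢vs ∷ Dvs) (here refl) x~y = begin
  subsetSum (suc k) hasDistinctSources (x ∷ vs ++ [ y ])
    ≡⟨ subsetSum-suc-∷ k hasDistinctSources x (vs ++ [ y ]) ⟩
  label x * subsetSum k (hasDistinctSources ∘ (x ∷_)) (vs ++ [ y ])
    + subsetSum (suc k) hasDistinctSources (vs ++ [ y ])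
    ≡⟨ cong₂ (λ s t → label x * s + t) with-x without-x ⟩
  label x * σ k V + σ (suc k) (V ++ [ label y ])
    ≡⟨ σ-∷-++-[] k (label x) V (label y) ⟩
  σ (suc k) (label x ∷ V ++ [ label y ]) - (label x * label y) * σ₋₂ (suc k) V
    ≡⟨ cong₂ (λ W U → σ (suc k) (label x ∷ W) - (label x * label y) * σ₋₂ (suc k) (map label U))
             (sym (map-++ label vs [ y ])) (sym filter-x∷vs) ⟩
  σ (suc k) (map label (x ∷ vs ++ [ y ]))
    - (label x * label y) * σ₋₂ (suc k) (map label (filterᵇ q (x ∷ vs)))
    ∎
  where
    open ≡-Reasoning
    V = map label vs
    q = λ e → not (src e ≡ᵇ src y)
    x≢? = λ f → ¬? (src x ≟ src f)
    vs≢y : All (λ v → src v ≢ src y) vs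
    vs≢y = All.map (λ x≢v v~y → x≢v (trans x~y (sym v~y))) x≢vs
    Dvs++y : DistinctSources (vs ++ [ y ])
    Dvs++y = AllPairs.++⁺ Dvs ([] ∷ []) (All.map (_∷ []) vs≢y)
    with-x : subsetSum k (hasDistinctSources ∘ (x ∷_)) (vs ++ [ y ]) ≡ σ k V
    with-x = trans (subsetSum-cong k {q = does ∘ All.all? x≢?} (vs ++ [ y ])
                     (λ {F} F⊆ _ → trans (cong (does (All.all? x≢? F) ∧_)
                                                (dec-true (distinctSources? F) (AllPairs-resp-⊆ F⊆ Dvs++y)))
                                          (∧-identityʳ _)))
                   (subsetSum-avoiding-last k x≢? x≢vs (λ x≢y → x≢y x~y))
    without-x : subsetSum (suc k) hasDistinctSources (vs ++ [ y ]) ≡ σ (suc k) (V ++ [ label y ])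
    without-x = trans (subsetSum-all (suc k) hasDistinctSources (vs ++ [ y ])
                        (λ {F} F⊆ → Equivalence.from (T-does⇔ (distinctSources? F)) (AllPairs-resp-⊆ F⊆ Dvs++y)))
                      (cong (σ (suc k)) (map-++ label vs [ y ]))
    filter-x∷vs : filterᵇ q (x ∷ vs) ≡ vs
    filter-x∷vs = trans
      (filter-reject (T? ∘ q) {x} {vs} (λ t → Equivalence.to (T-does⇔ (¬? (src x ≟ src y))) t x~y))
      (filter-all (T? ∘ q) (All.map ≢⇒T-not-≡ᵇ vs≢y))
subsetSum-oneClash (suc k) {u ∷ us} {x} {y} (u≢us ∷ Dus) (there x∈us) x~y = begin
  subsetSum (suc k) hasDistinctSources (u ∷ us ++ [ y ])
    ≡⟨ subsetSum-∷-unclashed k u (us ++ [ y ]) (All.++⁺ u≢us (u≢y ∷ [])) ⟩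
  label u * subsetSum k hasDistinctSources (us ++ [ y ]) + subsetSum (suc k) hasDistinctSources (us ++ [ y ])
    ≡⟨ cong₂ (λ s t → label u * s + t) (subsetSum-oneClash k Dus x∈us x~y)
                                       (subsetSum-oneClash (suc k) Dus x∈us x~y) ⟩
  label u * (σ k W - c * σ₋₂ k U) + (σ (suc k) W - c * σ₋₂ (suc k) U)
    ≡⟨ solve (label u) c (σ k W) (σ (suc k) W) (σ₋₂ k U) (σ₋₂ (suc k) U) ⟩
  σ (suc k) (label u ∷ W) - c * (label u * σ₋₂ k U + σ₋₂ (suc k) U)
    ≡⟨ cong (λ s → σ (suc k) (label u ∷ W) - c * s) (sym (σ₋₂-∷ k (label u) U)) ⟩
  σ (suc k) (label u ∷ W) - c * σ₋₂ (suc k) (label u ∷ U)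
    ≡⟨ cong (λ F → σ (suc k) (label u ∷ W) - c * σ₋₂ (suc k) (map label F))
            (sym (filter-accept (T? ∘ q) {u} {us} (≢⇒T-not-≡ᵇ u≢y))) ⟩
  σ (suc k) (map label (u ∷ us ++ [ y ])) - c * σ₋₂ (suc k) (map label (filterᵇ q (u ∷ us)))
    ∎
  where
    open ≡-Reasoning
    c = label x * label y
    q = λ e → not (src e ≡ᵇ src y)
    W = map label (us ++ [ y ])
    U = map label (filterᵇ q us)
    u≢y : src u ≢ src y
    u≢y u~y = All.lookup u≢us x∈us (trans u~y (sym x~y))
    solve : ∀ a c s₀ s₁ t₀ t₁ → a * (s₀ - c * t₀) + (s₁ - c * t₁) ≡ (a * s₀ + s₁) - c * (a * t₀ + t₁)
    solve = solve-∀

-- Reachability and acyclicity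

SameSide : Pred ℕ ℓ′ → Edge → Set ℓ′
SameSide S e = S (src e) ⇔ S (tgt e)

uReach-cut : ∀ (S : Pred ℕ ℓ′) {F} → All (SameSide S) F →
  ∀ k {u v} → S u → ¬ S v → ¬ T (uReach k F u v)
uReach-cut S F-uncut zero {u} {v} Su ¬Sv u≡ᵇv = ¬Sv (subst S (ℕ.≡ᵇ⇒≡ u v u≡ᵇv) Su)
uReach-cut S {F} F-uncut (suc k) {u} {v} Su ¬Sv t with Equivalence.to T-∨ t
... | inj₁ t′ = uReach-cut S F-uncut k Su ¬Sv t′
... | inj₂ t′ with e , e∈F , step ← find (any⁻ _ F t′) with Equivalence.to T-∨ step
...   | inj₁ fwd with e≡u , reach ← Equivalence.to T-∧ fwd = uReach-cut S F-uncut k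
  (Equivalence.to (All.lookup F-uncut e∈F) (subst S (sym (ℕ.≡ᵇ⇒≡ _ u e≡u)) Su)) ¬Sv reach
...   | inj₂ bwd with e≡u , reach ← Equivalence.to T-∧ bwd = uReach-cut S F-uncut k
  (Equivalence.from (All.lookup F-uncut e∈F) (subst S (sym (ℕ.≡ᵇ⇒≡ _ u e≡u)) Su)) ¬Sv reach

dReach-cut : ∀ (S : Pred ℕ ℓ′) {F} → All (λ e → S (src e) → S (tgt e)) F →
  ∀ k {u v} → S u → ¬ S v → ¬ T (dReach k F u v)
dReach-cut S F-closed zero {u} {v} Su ¬Sv u≡ᵇv = ¬Sv (subst S (ℕ.≡ᵇ⇒≡ u v u≡ᵇv) Su)
dReach-cut S {F} F-closed (suc k) {u} {v} Su ¬Sv t with Equivalence.to T-∨ t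
... | inj₁ t′ = dReach-cut S F-closed k Su ¬Sv t′
... | inj₂ t′ with e , e∈F , step ← find (any⁻ _ F t′) with e≡u , reach ← Equivalence.to T-∧ step =
  dReach-cut S F-closed k (All.lookup F-closed e∈F (subst S (sym (ℕ.≡ᵇ⇒≡ _ u e≡u)) Su)) ¬Sv reach

dReach-bounded : ∀ {F} → All (λ e → tgt e ≤ suc (src e)) F →
  ∀ k {u v} → u +ℕ k ℕ.< v → ¬ T (dReach k F u v)
dReach-bounded F-short zero {u} {v} u+0<v u≡ᵇv =
  ℕ.<-irrefl (trans (ℕ.+-identityʳ u) (ℕ.≡ᵇ⇒≡ u v u≡ᵇv)) u+0<v
dReach-bounded {F} F-short (suc k) {u} {v} u+k+1<v t with Equivalence.to T-∨ t
... | inj₁ t′ = dReach-bounded F-short k (ℕ.<-trans (ℕ.+-monoʳ-< u (ℕ.n<1+n k)) u+k+1<v) t′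
... | inj₂ t′ with e , e∈F , step ← find (any⁻ _ F t′) with e≡u , reach ← Equivalence.to T-∧ step =
  dReach-bounded F-short k tgt+k<v reach
  where
    tgt+k<v : tgt e +ℕ k ℕ.< v
    tgt≤u+1 : tgt e ≤ suc u
    tgt≤u+1 = subst (λ w → tgt e ≤ suc w) (ℕ.≡ᵇ⇒≡ (src e) u e≡u) (All.lookup F-short e∈F)
    tgt+k<v = ℕ.≤-<-trans (ℕ.+-monoˡ-≤ k tgt≤u+1) (subst (ℕ._< v) (ℕ.+-suc u k) u+k+1<v)

dReach-chain : ∀ F k u → (∀ {m} → u ≤ m → m ℕ.< u +ℕ k → Any (λ e → src e ≡ m × tgt e ≡ suc m) F) →
  T (dReach k F u (u +ℕ k))
dReach-chain F zero    u _     = ℕ.≡⇒≡ᵇ u (u +ℕ 0) (sym (ℕ.+-identityʳ u))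
dReach-chain F (suc k) u edges = Equivalence.from T-∨ (inj₂
  (any⁺ (λ e → (src e ≡ᵇ u) ∧ dReach k F (tgt e) (u +ℕ suc k))
        (Any.map (λ {e} → first {e}) (edges {u} ℕ.≤-refl (ℕ.m<m+n u ℕ.0<1+n)))))
  where
    rest : T (dReach k F (suc u) (u +ℕ suc k))
    rest = subst (T ∘ dReach k F (suc u)) (sym (ℕ.+-suc u k)) (dReach-chain F k (suc u)
      (λ {m} u<m m<u+k → edges (ℕ.<⇒≤ u<m) (subst (m ℕ.<_) (sym (ℕ.+-suc u k)) m<u+k)))
    first : ∀ {e} → src e ≡ u × tgt e ≡ suc u → T ((src e ≡ᵇ u) ∧ dReach k F (tgt e) (u +ℕ suc k))
    first (refl , refl) = Equivalence.from T-∧ (ℕ.≡⇒≡ᵇ u u refl , rest)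

removeEach-∈ : ∀ (F : List A) {e rest} → (e , rest) ∈ removeEach F → e ∈ F
removeEach-∈ (x ∷ F) (here refl) = here refl
removeEach-∈ (x ∷ F) (there p)   with _ , p′ , refl ← ∈-map⁻ _ p = there (removeEach-∈ F p′)

removeEach-All : ∀ {R : A → A → Set ℓ′} {F e rest} →
  AllPairs (λ e f → R e f × R f e) F → (e , rest) ∈ removeEach F → All (R e) rest
removeEach-All             (Rx ∷ _)  (here refl) = All.map proj₁ Rx
removeEach-All {F = _ ∷ F} (Rx ∷ RF) (there p)   with _ , p′ , refl ← ∈-map⁻ _ p =
  proj₂ (All.lookup Rx (removeEach-∈ F p′)) ∷ removeEach-All RF p′

acyclic-if-bridges : ∀ (S : Edge → Pred ℕ ℓ′) {F} →
  All (λ e → S e (src e) × ¬ S e (tgt e)) F →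
  AllPairs (λ e f → SameSide (S e) f × SameSide (S f) e) F →
  T (acyclic F)
acyclic-if-bridges S {F} separated uncut = All.all⁻ _ {removeEach F} (All.tabulate λ { {e , rest} p∈ →
  let Se-src , ¬Se-tgt = All.lookup separated (removeEach-∈ F p∈)
  in Equivalence.from (T-does⇔ (¬? (T? _)))
       (uReach-cut (S e) (removeEach-All uncut p∈) (length rest) Se-src ¬Se-tgt) })

-- The model 𝓜_i, with n = suc N and i = suc i′

suc∸∸1< : ∀ {N} j → 1 ≤ j → j ≤ N → suc N ∸ j ∸ 1 ℕ.< N
suc∸∸1< {suc N} (suc j) _ _ = s≤s (ℕ.∸-monoˡ-≤ 1 (ℕ.m∸n≤m (suc N) j))

module PathModel (N i′ : ℕ) (i≤N : suc i′ ≤ N) (a : ℕ → ℤ) (ℓ : ℤ) where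

  i : ℕ
  i = suc i′

  model : Model
  model = pathModel (suc N) i a ℓ

  pathEdge : ℕ → Edge
  pathEdge k = edge k (suc k) (a k)

  leakEdge : Edge
  leakEdge = edge i 0 ℓ

  path : List Edge
  path = map pathEdge (oneTo N)

  allEdges : List Edge
  allEdges = path ++ [ leakEdge ]

  ∈-path⁺ : ∀ {k} → k ℕ.< N → pathEdge (suc k) ∈ path
  ∈-path⁺ k<N = ∈-map⁺ pathEdge (∈-map⁺ suc (∈-upTo⁺ k<N))

  data ModelEdge : Edge → Set where
    leak : ModelEdge leakEdge
    step : ∀ {k} → k ℕ.< N → ModelEdge (pathEdge (suc k))

  ∈-allEdges⁻ : ∀ {e} → e ∈ allEdges → ModelEdge e
  ∈-allEdges⁻ e∈ with ∈-++⁻ path e∈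
  ... | inj₂ (here refl) = leak
  ... | inj₁ e∈path
    with _ , m∈ , refl ← ∈-map⁻ pathEdge e∈path
    with _ , k∈ , refl ← ∈-map⁻ suc m∈ = step (∈-upTo⁻ k∈)

  length-path : length path ≡ N
  length-path = trans (length-map pathEdge (oneTo N)) (length-oneTo N)

  length-allEdges : length allEdges ≡ suc N
  length-allEdges = trans (length-++ path) (trans (cong (_+ℕ 1) length-path) (ℕ.+-comm N 1))

  path⊆allEdges : path ⊆ allEdges
  path⊆allEdges = ⊆-++⁺ʳ [ leakEdge ] ⊆-refl

  path-distinctSources : DistinctSources path
  path-distinctSources =
    AllPairs.map⁺ (AllPairs.map⁺ (AllPairs.applyUpTo⁺₁ id N (λ j<k _ → ℕ.<⇒≢ (s≤s j<k))))

  leak-clash : ¬ DistinctSources allEdges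
  leak-clash D
    with () ← cong tgt (src-injective D (∈-++⁺ˡ (∈-path⁺ i≤N)) (∈-++⁺ʳ path (here refl)) refl)

  -- The vertices on the side of src e once e is deleted from the tree.
  cut : Edge → Pred ℕ 0ℓ
  cut (edge _ zero    _) v       = v ≢ 0
  cut (edge m (suc _) _) zero    = i ≤ m
  cut (edge m (suc _) _) (suc v) = suc v ≤ m

  cut-separates : All (λ e → cut e (src e) × ¬ cut e (tgt e)) allEdges
  cut-separates = All.tabulate (separates ∘ ∈-allEdges⁻)
    where
      separates : ∀ {e} → ModelEdge e → cut e (src e) × ¬ cut e (tgt e)
      separates leak     = (λ ()) , (λ 0≢0 → 0≢0 refl)
      separates (step _) = ℕ.≤-refl , ℕ.<-irrefl refl

  cuts-uncrossed : AllPairs (λ e f → SameSide (cut e) f × SameSide (cut f) e) allEdges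
  cuts-uncrossed = AllPairs.++⁺ path-path ([] ∷ []) (All.map (_∷ []) path-leak)
    where
      path-path : AllPairs (λ e f → SameSide (cut e) f × SameSide (cut f) e) path
      path-path = AllPairs.map⁺ (AllPairs.map⁺ (AllPairs.applyUpTo⁺₁ id N λ j<k _ →
        mk⇔ (λ k≤j → ⊥-elim (ℕ.<⇒≱ j<k (ℕ.≤-pred k≤j)))
            (λ k<j → ⊥-elim (ℕ.<-asym j<k (ℕ.≤-pred k<j))) ,
        mk⇔ (λ _ → s≤s j<k) (λ _ → s≤s (ℕ.<⇒≤ j<k))))
      path-leak : All (λ e → SameSide (cut e) leakEdge × SameSide (cut leakEdge) e) path
      path-leak = All.map⁺ (All.map⁺ (All.applyUpTo⁺₂ id N λ _ →
        mk⇔ id id , mk⇔ (const λ ()) (const λ ())))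

  isIncomingForest≡hasDistinctSources : ∀ {F} → F ⊆ allEdges → isIncomingForest F ≡ hasDistinctSources F
  isIncomingForest≡hasDistinctSources {F} F⊆ = trans
    (cong (_∧ outdegLeq1 F) (Equivalence.to T-≡
      (acyclic-if-bridges cut (All-resp-⊆ F⊆ cut-separates) (AllPairs-resp-⊆ F⊆ cuts-uncrossed))))
    (outdegLeq1≡hasDistinctSources F)

  GtildeStar≡allEdges : GtildeStar model ≡ allEdges
  GtildeStar≡allEdges =
    filter-all (T? ∘ λ e → not (src e ≡ᵇ suc N)) (All.tabulate (src≢n ∘ ∈-allEdges⁻))
    where
      src≢n : ∀ {e} → ModelEdge e → T (not (src e ≡ᵇ suc N))
      src≢n leak       = ≢⇒T-not-≡ᵇ (ℕ.<⇒≢ (s≤s i≤N))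
      src≢n (step k<N) = ≢⇒T-not-≡ᵇ (ℕ.<⇒≢ (s≤s k<N))

  allEdges-short : All (λ e → tgt e ≤ suc (src e)) allEdges
  allEdges-short = All.tabulate (short ∘ ∈-allEdges⁻)
    where
      short : ∀ {e} → ModelEdge e → tgt e ≤ suc (src e)
      short leak     = z≤n
      short (step _) = ℕ.≤-refl

  path-is-forest-with-path : T (isIncomingForest path ∧ hasPath 1 (suc N) path)
  path-is-forest-with-path = Equivalence.from T-∧
    ( subst T (sym (isIncomingForest≡hasDistinctSources path⊆allEdges))
        (Equivalence.from (T-does⇔ (distinctSources? path)) path-distinctSources)
    , subst (λ k → T (dReach k path 1 (suc N))) (sym length-path) (dReach-chain path N 1 steps))
    where
      steps : ∀ {m} → 1 ≤ m → m ℕ.< suc N → Any (λ e → src e ≡ m × tgt e ≡ suc m) path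
      steps {suc k} _ (s≤s k<N) = Any.map (λ { refl → refl , refl }) (∈-path⁺ k<N)

  leak∈⇒no-path : ∀ {F} → F ⊆ allEdges → DistinctSources F → leakEdge ∈ F →
    ¬ T (hasPath 1 (suc N) F)
  leak∈⇒no-path {F} F⊆ D leak∈F =
    dReach-cut (_≤ i) (All.tabulate closed) (length F) (s≤s z≤n) (ℕ.<⇒≱ (s≤s i≤N))
    where
      closed : ∀ {f} → f ∈ F → src f ≤ i → tgt f ≤ i
      closed f∈F with ∈-allEdges⁻ (lookup F⊆ f∈F)
      ... | leak       = λ _ → z≤n
      ... | step {k} _ = λ k+1≤i → ℕ.≤∧≢⇒< k+1≤i λ k+1≡i →
        suc≢0 (cong tgt (src-injective D f∈F leak∈F k+1≡i))
        where
          suc≢0 : suc (suc k) ≢ 0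
          suc≢0 ()

  forest-with-path⇔no-leak : ∀ {F} → F ⊆ allEdges → length F ≡ N →
    T (isIncomingForest F ∧ hasPath 1 (suc N) F) ⇔ All (λ e → tgt e ≢ 0) F
  forest-with-path⇔no-leak {F} F⊆ len = mk⇔ to from
    where
      to : T (isIncomingForest F ∧ hasPath 1 (suc N) F) → All (λ e → tgt e ≢ 0) F
      to t with forest , has-path ← Equivalence.to T-∧ t =
        All.tabulate λ e∈F → not-leak e∈F (∈-allEdges⁻ (lookup F⊆ e∈F))
        where
          D = Equivalence.to (T-does⇔ (distinctSources? F))
                (subst T (isIncomingForest≡hasDistinctSources F⊆) forest)
          not-leak : ∀ {e} → e ∈ F → ModelEdge e → tgt e ≢ 0
          not-leak e∈F leak     _  = leak∈⇒no-path F⊆ D e∈F has-path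
          not-leak e∈F (step _) ()
      from : All (λ e → tgt e ≢ 0) F → T (isIncomingForest F ∧ hasPath 1 (suc N) F)
      from no-leak = subst (λ G → T (isIncomingForest G ∧ hasPath 1 (suc N) G))
        (sym (⊆∧length≡⇒≡ (⊆-++-[]⁻ path no-leak (λ 0≢0 → 0≢0 refl) F⊆) (trans len (sym length-path))))
        path-is-forest-with-path

  c₀≡0 : cCoeff model 0 ≡ + 0
  c₀≡0 = trans (subsetSum-cong (suc N) allEdges (λ F⊆ _ → isIncomingForest≡hasDistinctSources F⊆))
    (subsetSum-none (suc N) hasDistinctSources allEdges λ {F} F⊆ len →
      leak-clash ∘ subst DistinctSources (⊆∧length≡⇒≡ F⊆ (trans len (sym length-allEdges)))
                 ∘ Equivalence.to (T-does⇔ (distinctSources? F)))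

  dⱼ≡0 : ∀ j → 1 ≤ j → j ≤ N → dCoeff model j ≡ + 0
  dⱼ≡0 j 1≤j j≤N = begin
    dCoeff model j
      ≡⟨ cong (Σπ ∘ forestsPath 1 (suc N) k) GtildeStar≡allEdges ⟩
    Σπ (forestsPath 1 (suc N) k allEdges)
      ≡⟨ forestsPath≡subsetSum 1 (suc N) k allEdges ⟩
    subsetSum k (λ F → isIncomingForest F ∧ hasPath 1 (suc N) F) allEdges
      ≡⟨ subsetSum-none k _ allEdges too-short ⟩
    + 0
      ∎
    where
      open ≡-Reasoning
      k = suc N ∸ j ∸ 1
      too-short : ∀ {F} → F ⊆ allEdges → length F ≡ k → ¬ T (isIncomingForest F ∧ hasPath 1 (suc N) F)
      too-short {F} F⊆ len t = dReach-bounded (All-resp-⊆ F⊆ allEdges-short) (length F)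
        (s≤s (subst (ℕ._< N) (sym len) (suc∸∸1< j 1≤j j≤N))) (proj₂ (Equivalence.to T-∧ t))

  cⱼ≡σ-formula : ∀ j → j ≤ suc N →
    cCoeff model j
      ≡ σ (suc N ∸ j) (Qset (suc N) a ℓ) - (ℓ * a i) * σℤ (+ suc N - + j - + 2) (Qminus (suc N) i a)
  cⱼ≡σ-formula j j≤n = begin
    cCoeff model j
      ≡⟨ subsetSum-cong k allEdges (λ F⊆ _ → isIncomingForest≡hasDistinctSources F⊆) ⟩
    subsetSum k hasDistinctSources (path ++ [ leakEdge ])
      ≡⟨ subsetSum-oneClash k path-distinctSources (∈-path⁺ i≤N) refl ⟩
    σ k (map label allEdges) - (a i * ℓ) * σ₋₂ k (map label (filterᵇ ≢i path))
      ≡⟨ cong₂ (λ Q U → σ k Q - (a i * ℓ) * σ₋₂ k U) labels-allEdges labels-≢i ⟩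
    σ k (Qset (suc N) a ℓ) - (a i * ℓ) * σ₋₂ k (Qminus (suc N) i a)
      ≡⟨ cong₂ (λ c s → σ k (Qset (suc N) a ℓ) - c * s)
               (ℤ.*-comm (a i) ℓ) (sym (σℤ≡σ₋₂ j≤n (Qminus (suc N) i a))) ⟩
    σ k (Qset (suc N) a ℓ) - (ℓ * a i) * σℤ (+ suc N - + j - + 2) (Qminus (suc N) i a)
      ∎
    where
      open ≡-Reasoning
      k = suc N ∸ j
      ≢i = λ e → not (src e ≡ᵇ i)
      labels-allEdges : map label allEdges ≡ Qset (suc N) a ℓ
      labels-allEdges =
        trans (map-++ label path [ leakEdge ]) (cong (_++ [ ℓ ]) (sym (map-∘ (oneTo N))))
      labels-≢i : map label (filterᵇ ≢i path) ≡ Qminus (suc N) i a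
      labels-≢i = trans (cong (map label) (filterᵇ-map ≢i pathEdge (oneTo N))) (sym (map-∘ _))

  d₀≡∏a : dCoeff model 0 ≡ prodℤ (map a (oneTo N))
  d₀≡∏a = begin
    dCoeff model 0
      ≡⟨ cong (Σπ ∘ forestsPath 1 (suc N) N) GtildeStar≡allEdges ⟩
    Σπ (forestsPath 1 (suc N) N allEdges)
      ≡⟨ forestsPath≡subsetSum 1 (suc N) N allEdges ⟩
    subsetSum N (λ F → isIncomingForest F ∧ hasPath 1 (suc N) F) allEdges
      ≡⟨ subsetSum-cong N allEdges no-leak ⟩
    subsetSum N (does ∘ All.all? ¬leak?) (path ++ [ leakEdge ])
      ≡⟨ subsetSum-avoiding-last N ¬leak? path-no-leak (λ 0≢0 → 0≢0 refl) ⟩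
    σ N (map label path)
      ≡⟨ cong (σ N) (sym (map-∘ (oneTo N))) ⟩
    σ N (map a (oneTo N))
      ≡⟨ cong (λ k → σ k (map a (oneTo N))) (sym length-a) ⟩
    σ (length (map a (oneTo N))) (map a (oneTo N))
      ≡⟨ σ-length (map a (oneTo N)) ⟩
    prodℤ (map a (oneTo N))
      ∎
    where
      open ≡-Reasoning
      ¬leak? = λ e → ¬? (tgt e ≟ 0)
      no-leak : ∀ {F} → F ⊆ allEdges → length F ≡ N →
        isIncomingForest F ∧ hasPath 1 (suc N) F ≡ does (All.all? ¬leak? F)
      no-leak {F} F⊆ len = does-⇔ (forest-with-path⇔no-leak F⊆ len) (T? _) (All.all? ¬leak? F)
      path-no-leak : All (λ e → tgt e ≢ 0) path
      path-no-leak = All.map⁺ (All.map⁺ (All.applyUpTo⁺₂ id N (λ _ ())))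
      length-a : length (map a (oneTo N)) ≡ N
      length-a = trans (length-map a (oneTo N)) (length-oneTo N)

proposition3p1 : (n i : ℕ) → 2 ≤ n → 1 ≤ i → i ≤ n ∸ 1 →
    (a : ℕ → ℤ) → (ℓ : ℤ) →
    (∀ k → 1 ≤ k → k ≤ n ∸ 1 → + 0 < a k) → + 0 < ℓ →
    (cCoeff (pathModel n i a ℓ) 0 ≡ + 0)
    × (∀ j → 1 ≤ j → j ≤ n ∸ 1 → dCoeff (pathModel n i a ℓ) j ≡ + 0)
    × (∀ j → 1 ≤ j → j ≤ n ∸ 1 →
         cCoeff (pathModel n i a ℓ) j
           ≡ σ (n ∸ j) (Qset n a ℓ)
             - (ℓ * a i) * σℤ (+ n - + j - + 2) (Qminus n i a))
    × (dCoeff (pathModel n i a ℓ) 0 ≡ prodℤ (map a (oneTo (n ∸ 1))))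
proposition3p1 (suc N) (suc i′) (s≤s (s≤s z≤n)) (s≤s z≤n) i≤N a ℓ _ _ =
  c₀≡0 , dⱼ≡0 , (λ j _ j≤N → cⱼ≡σ-formula j (ℕ.m≤n⇒m≤1+n j≤N)) , d₀≡∏a
  where open PathModel N i′ i≤N a ℓ
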